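{- Let $G$ be an $r$-regular interval colorable graph and let $n\geq 2$ be an integer. Then $G\square C_{2n}$ is interval colorable and $$W(G\square C_{2n})\geq W(G)+W(C_{2n})+nr,$$ where $W(C_{2n})=n+1$.
   Context: All graphs are finite, undirected, without loops or multiple edges. An edge-coloring of a graph $G$ with colors $1,\ldots,t$ is an interval $t$-coloring if all $t$ colors are used, and the colors of the edges incident to each vertex are distinct and form an interval of consecutive integers. A graph is interval colorable if it has an interval $t$-coloring for some positive integer $t$; for such a graph, $W(G)$ is the greatest such $t$. $C_{2n}$ is the cycle on $2n$ vertices. The Cartesian product $G\square H$ has vertex set $V(G)\times V(H)$, with $(u_1,v_1)(u_2,v_2)$ an edge iff either $u_1=u_2$ and $v_1v_2\in E(H)$, or $v_1=v_2$ and $u_1u_2\in E(G)$. -}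

module Defs where

open import Level using (0ℓ)
open import Data.Nat using (ℕ; zero; suc; _+_; _*_; _≤_)
open import Data.Fin using (Fin; toℕ)
open import Data.List using (List; length; allFin; cartesianProduct)
open import Data.List.Membership.Propositional using (_∈_)
open import Data.List.Membership.Propositional.Properties using (∈-allFin; ∈-cartesianProduct⁺)
open import Data.List.Relation.Unary.Unique.Propositional using (Unique)
open import Data.Product using (Σ; ∃; ∃-syntax; _×_; _,_; proj₁; proj₂)
open import Data.Sum using (_⊎_)
open import Relation.Nullary using (¬_)
open import Relation.Binary.PropositionalEquality using (_≡_)

record Graph : Set₁ where
  field
    V        : Set
    _~_      : V → V → Set
    elems    : List V
    complete : ∀ x → x ∈ elems
open Graph public

-- Simple (undirected, no loops).  Multiple edges are impossible because
-- colorings below are functions of the endpoints only.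
record Simple (G : Graph) : Set where
  field
    sym   : ∀ {x y} → _~_ G x y → _~_ G y x
    irrefl : ∀ {x} → ¬ (_~_ G x x)

HasDegree : (G : Graph) → V G → ℕ → Set
HasDegree G x d =
  Σ (List (V G)) λ ns → Unique ns × (∀ y → (y ∈ ns → _~_ G x y) × (_~_ G x y → y ∈ ns)) × length ns ≡ d

Regular : Graph → ℕ → Set
Regular G r = ∀ x → HasDegree G x r

IsIntervalColoring : (G : Graph) → ℕ → (V G → V G → ℕ) → Set
IsIntervalColoring G t c =
  (∀ {x y} → _~_ G x y → c x y ≡ c y x) ×
  (∀ {x y} → _~_ G x y → 1 ≤ c x y × c x y ≤ t) ×
  (∀ k → 1 ≤ k → k ≤ t → ∃[ x ] ∃[ y ] (_~_ G x y × c x y ≡ k)) ×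
  (∀ {x y z} → _~_ G x y → _~_ G x z → c x y ≡ c x z → y ≡ z) ×
  (∀ {x y z} k → _~_ G x y → _~_ G x z → c x y ≤ k → k ≤ c x z →
     ∃[ w ] (_~_ G x w × c x w ≡ k))

HasIntervalColoring : Graph → ℕ → Set
HasIntervalColoring G t = ∃[ c ] IsIntervalColoring G t c

IntervalColorable : Graph → Set
IntervalColorable G = ∃[ t ] (1 ≤ t × HasIntervalColoring G t)

IsW : Graph → ℕ → Set
IsW G w = HasIntervalColoring G w × (∀ t → HasIntervalColoring G t → t ≤ w)

_□_ : Graph → Graph → Graph
G □ H = record
  { V = V G × V H
  ; _~_ = λ p q → (proj₁ p ≡ proj₁ q × _~_ H (proj₂ p) (proj₂ q))
                ⊎ (proj₂ p ≡ proj₂ q × _~_ G (proj₁ p) (proj₁ q))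
  ; elems = cartesianProduct (elems G) (elems H)
  ; complete = λ p → ∈-cartesianProduct⁺ (complete G (proj₁ p)) (complete H (proj₂ p))
  }

-- The cycle on m vertices 0,…,m-1 (edges i(i+1) and 0(m-1)); a simple
-- cycle C_m for m ≥ 3.
CycleAdj : ℕ → ℕ → ℕ → Set
CycleAdj m i j = (suc i ≡ j) ⊎ (suc j ≡ i) ⊎ (i ≡ 0 × suc j ≡ m) ⊎ (j ≡ 0 × suc i ≡ m)

Cycle : ℕ → Graph
Cycle m = record
  { V = Fin m
  ; _~_ = λ i j → CycleAdj m (toℕ i) (toℕ j)
  ; elems = allFin m
  ; complete = ∈-allFin
  }

module Submission where

-- Plan.  (1) In an interval colouring of G the colours at a vertex x of
-- degree r fill an interval [low x, low x + r) (its spectrum).  (2) On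
-- C_{2n} we fix explicit edge offsets E and vertex shifts S such that at
-- each cycle vertex the two cycle offsets and the shifted interval
-- [S i, S i + r) tile an interval of length r + 2 (a block).  (3) Colouring
-- G-edges of the i-th layer by α + S i and the cycle edges at x by
-- low x + (offset) then gives an interval colouring of G □ C_{2n} with
-- W(G) + (n + 1) + n r colours.  (4) With G a single vertex the same
-- construction gives an interval (n + 1)-colouring of C_{2n}, and
-- (5) conversely colours of consecutive cycle edges differ by one, which
-- bounds W(C_{2n}) by n + 1.

open import Defs
open import Data.Nat using (ℕ; zero; suc; pred; >-nonZero; _+_; _*_; _∸_; _≤_; _<_; z≤n; s≤s; _≟_; _<?_; _≤?_)
open import Data.Nat.Properties
open import Data.Nat.Tactic.RingSolver using (solve-∀)
open import Data.Fin using (Fin; toℕ; fromℕ<)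
open import Data.Fin.Properties using (toℕ-fromℕ<; toℕ-injective; toℕ<n)
open import Data.Unit using (⊤; tt)
open import Data.Product using (Σ; ∃-syntax; _×_; _,_; proj₁; proj₂)
open import Data.Sum using (_⊎_; inj₁; inj₂)
open import Data.Empty using (⊥; ⊥-elim)
open import Data.List using (List; []; _∷_; length; map; applyUpTo)
open import Data.List.Properties using (length-map; length-applyUpTo)
open import Data.List.Membership.Propositional using (_∈_)
open import Data.List.Membership.Propositional.Properties using (∈-map⁺; ∈-map⁻; ∈-applyUpTo⁺; ∈-applyUpTo⁻)
open import Data.List.Membership.Propositional.Properties.WithK using (unique∧set⇒bag)
open import Data.List.Relation.Unary.Any using (here; there)
open import Data.List.Relation.Unary.All using (lookup)
import Data.List.Relation.Unary.All as All
import Data.List.Relation.Unary.All.Properties as AllP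
open import Data.List.Relation.Unary.AllPairs using ([]; _∷_)
open import Data.List.Relation.Unary.Unique.Propositional using (Unique)
open import Data.List.Relation.Unary.Unique.Propositional.Properties using (applyUpTo⁺₁)
open import Data.List.Relation.Binary.BagAndSetEquality using (∼bag⇒↭)
open import Data.List.Relation.Binary.Permutation.Propositional.Properties using (↭-length)
import Data.List.Extrema
open import Function.Bundles using (mk⇔)
open import Relation.Nullary using (¬_; yes; no)
open import Relation.Binary.Definitions using (tri<; tri≈; tri>)
open import Relation.Binary.PropositionalEquality

open Data.List.Extrema ≤-totalOrder
  using (argmin; argmax; argmin-sel; argmax-sel; f[argmin]≤f[⊤]; f[argmin]≤f[xs]; f[⊥]≤f[argmax]; f[xs]≤f[argmax])

map-unique : ∀ {A : Set} (f : A → ℕ) (xs : List A) →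
  (∀ {a b} → a ∈ xs → b ∈ xs → f a ≡ f b → a ≡ b) → Unique xs → Unique (map f xs)
map-unique f [] inj u = []
map-unique f (a ∷ xs) inj (a∉xs ∷ u) =
  AllP.map⁺ (All.tabulate λ y∈xs eq → lookup a∉xs y∈xs (inj (here refl) (there y∈xs) eq))
  ∷ map-unique f xs (λ p q → inj (there p) (there q)) u

range-unique : ∀ m d → Unique (applyUpTo (m +_) d)
range-unique m d = applyUpTo⁺₁ (m +_) d (λ i<j _ eq → <⇒≢ i<j (+-cancelˡ-≡ m _ _ eq))

same-members⇒same-length : ∀ {xs ys : List ℕ} → Unique xs → Unique ys →
  (∀ {k} → k ∈ xs → k ∈ ys) → (∀ {k} → k ∈ ys → k ∈ xs) → length xs ≡ length ys
same-members⇒same-length uxs uys to from =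
  ↭-length (∼bag⇒↭ (unique∧set⇒bag uxs uys (mk⇔ to from)))

-- The colours at a vertex of degree d in an interval t-colouring form an
-- interval [low, low + d) inside [1, t].  This is what lets the product
-- colouring shift the colours of G-edges at a vertex as one block.
module Spectra (G : Graph) (t : ℕ) (α : V G → V G → ℕ) (isα : IsIntervalColoring G t α) where
  private
    Adj = _~_ G
    α-range = proj₁ (proj₂ isα)
    α-proper = proj₁ (proj₂ (proj₂ (proj₂ isα)))
    α-interval = proj₂ (proj₂ (proj₂ (proj₂ isα)))

  record Spectrum (x : V G) (d : ℕ) : Set where
    field
      low      : ℕ
      low≥1    : 1 ≤ low
      low+d≤   : low + d ≤ suc t
      inside   : ∀ {y} → Adj x y → low ≤ α x y × α x y < low + d
      realised : ∀ k → low ≤ k → k < low + d → ∃[ y ] (Adj x y × α x y ≡ k)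

  spectrum : ∀ {x d} → HasDegree G x d → Spectrum x d
  spectrum {x} ([] , _ , nb , refl) = record
    { low = 1 ; low≥1 = ≤-refl ; low+d≤ = s≤s z≤n
    ; inside = λ a → ⊥-elim (no-neighbour (proj₂ (nb _) a))
    ; realised = λ k 1≤k k<1 → ⊥-elim (<-irrefl refl (≤-trans k<1 (subst (_≤ k) (sym (+-identityʳ 1)) 1≤k))) }
    where
    no-neighbour : ∀ {y} → ¬ (y ∈ [])
    no-neighbour ()
  spectrum {x} (ns@(y₀ ∷ ys) , unique , nb , refl) = record
    { low = low ; low≥1 = proj₁ (α-range adj-min)
    ; low+d≤ = subst (_≤ suc t) (sym size) (s≤s (proj₂ (α-range adj-max)))
    ; inside = λ {y} a → low≤ (member a) , subst (f y <_) (sym size) (s≤s (≤high (member a)))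
    ; realised = λ k l k< → α-interval k adj-min adj-max l (≤-pred (subst (k <_) size k<)) }
    where
    f = α x
    adjacent : ∀ {y} → y ∈ ns → Adj x y
    adjacent p = proj₁ (nb _) p
    member : ∀ {y} → Adj x y → y ∈ ns
    member a = proj₂ (nb _) a
    in-ns : ∀ {y} → (y ≡ y₀) ⊎ (y ∈ ys) → y ∈ ns
    in-ns (inj₁ refl) = here refl
    in-ns (inj₂ p) = there p
    adj-min = adjacent (in-ns (argmin-sel f y₀ ys))
    adj-max = adjacent (in-ns (argmax-sel f y₀ ys))
    low high : ℕ
    low = f (argmin f y₀ ys)
    high = f (argmax f y₀ ys)
    low≤ : ∀ {y} → y ∈ ns → low ≤ f y
    low≤ (here refl) = f[argmin]≤f[⊤] {f = f} y₀ ys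
    low≤ (there p) = lookup (f[argmin]≤f[xs] {f = f} y₀ ys) p
    ≤high : ∀ {y} → y ∈ ns → f y ≤ high
    ≤high (here refl) = f[⊥]≤f[argmax] {f = f} y₀ ys
    ≤high (there p) = lookup (f[xs]≤f[argmax] {f = f} y₀ ys) p
    low≤1+high : low ≤ suc high
    low≤1+high = ≤-trans (≤high (member adj-min)) (n≤1+n high)
    colours range : List ℕ
    colours = map f ns
    range = applyUpTo (low +_) (suc high ∸ low)
    colours⊆range : ∀ {k} → k ∈ colours → k ∈ range
    colours⊆range p with ∈-map⁻ f p
    ... | y , y∈ , refl = subst (_∈ range) (m+[n∸m]≡n (low≤ y∈))
          (∈-applyUpTo⁺ (low +_) (∸-monoˡ-< (s≤s (≤high y∈)) (low≤ y∈)))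
    range⊆colours : ∀ {k} → k ∈ range → k ∈ colours
    range⊆colours p with ∈-applyUpTo⁻ (low +_) p
    ... | i , i<d , refl with α-interval (low + i) adj-min adj-max (m≤m+n low i)
           (≤-pred (subst (low + i <_) (m+[n∸m]≡n low≤1+high) (+-monoʳ-< low i<d)))
    ... | y , a , eq = subst (_∈ colours) eq (∈-map⁺ f (member a))
    size : low + length ns ≡ suc high
    size = begin
      low + length ns              ≡⟨ cong (low +_) (sym (length-map f ns)) ⟩
      low + length colours         ≡⟨ cong (low +_) (same-members⇒same-length
                                        (map-unique f ns (λ p q → α-proper (adjacent p) (adjacent q)) unique)
                                        (range-unique low _) colours⊆range range⊆colours) ⟩
      low + length range           ≡⟨ cong (low +_) (length-applyUpTo (low +_) _) ⟩
      low + (suc high ∸ low)       ≡⟨ m+[n∸m]≡n low≤1+high ⟩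
      suc high                     ∎
      where open ≡-Reasoning

  low≡1 : ∀ {x y d} (s : Spectrum x d) → Adj x y → α x y ≡ 1 → Spectrum.low s ≡ 1
  low≡1 s a α≡1 = ≤-antisym (subst (Spectrum.low s ≤_) α≡1 (proj₁ (Spectrum.inside s a))) (Spectrum.low≥1 s)

module CycleWalk (N : ℕ) (3≤N : 3 ≤ N) where
  next : ℕ → ℕ
  next i with suc i ≟ N
  ... | yes _ = 0
  ... | no _ = suc i

  prev : ℕ → ℕ
  prev zero = pred N
  prev (suc i) = i

  0<N : 0 < N
  0<N = ≤-trans (s≤s z≤n) 3≤N

  1+[N-1]≡N : suc (pred N) ≡ N
  1+[N-1]≡N = suc-pred N {{>-nonZero 0<N}}

  next-suc : ∀ {i} → suc i < N → next i ≡ suc i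
  next-suc {i} lt with suc i ≟ N
  ... | yes eq = ⊥-elim (<-irrefl eq lt)
  ... | no _ = refl

  next< : ∀ {i} → i < N → next i < N
  next< {i} i<N with suc i ≟ N
  ... | yes _ = 0<N
  ... | no ne = ≤∧≢⇒< i<N ne

  prev< : ∀ {i} → i < N → prev i < N
  prev< {zero} _ = subst (pred N <_) 1+[N-1]≡N ≤-refl
  prev< {suc i} i<N = <-trans (n<1+n i) i<N

  next-prev : ∀ {i} → i < N → next (prev i) ≡ i
  next-prev {zero} _ with suc (pred N) ≟ N
  ... | yes _ = refl
  ... | no ne = ⊥-elim (ne 1+[N-1]≡N)
  next-prev {suc i} i<N with suc i ≟ N
  ... | yes eq = ⊥-elim (<-irrefl eq i<N)
  ... | no _ = refl

  prev-next : ∀ {i} → i < N → prev (next i) ≡ i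
  prev-next {i} i<N with suc i ≟ N
  ... | yes eq = suc-injective (trans 1+[N-1]≡N (sym eq))
  ... | no _ = refl

  adj-cases : ∀ {i j} → i < N → j < N → CycleAdj N i j → (j ≡ next i) ⊎ (i ≡ next j)
  adj-cases {i} {j} i<N j<N (inj₁ eq) with suc i ≟ N
  ... | yes e = ⊥-elim (<-irrefl (trans (sym eq) e) j<N)
  ... | no _ = inj₁ (sym eq)
  adj-cases {i} {j} i<N j<N (inj₂ (inj₁ eq)) with suc j ≟ N
  ... | yes e = ⊥-elim (<-irrefl (trans (sym eq) e) i<N)
  ... | no _ = inj₂ (sym eq)
  adj-cases {i} {j} i<N j<N (inj₂ (inj₂ (inj₁ (refl , e)))) with suc j ≟ N
  ... | yes _ = inj₂ refl
  ... | no ne = ⊥-elim (ne e)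
  adj-cases {i} {j} i<N j<N (inj₂ (inj₂ (inj₂ (refl , e)))) with suc i ≟ N
  ... | yes _ = inj₁ refl
  ... | no ne = ⊥-elim (ne e)

  adj-next : ∀ i → CycleAdj N i (next i)
  adj-next i with suc i ≟ N
  ... | yes e = inj₂ (inj₂ (inj₂ (refl , e)))
  ... | no _ = inj₁ refl

  adj-sym : ∀ {i j} → CycleAdj N i j → CycleAdj N j i
  adj-sym (inj₁ e) = inj₂ (inj₁ e)
  adj-sym (inj₂ (inj₁ e)) = inj₁ e
  adj-sym (inj₂ (inj₂ (inj₁ e))) = inj₂ (inj₂ (inj₂ e))
  adj-sym (inj₂ (inj₂ (inj₂ e))) = inj₂ (inj₂ (inj₁ e))

  adj-prev : ∀ {i} → i < N → CycleAdj N i (prev i)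
  adj-prev {i} i<N = subst (λ k → CycleAdj N k (prev i)) (next-prev i<N) (adj-sym (adj-next (prev i)))

  adj-irrefl : ∀ {i j} → CycleAdj N i j → ¬ i ≡ j
  adj-irrefl (inj₁ e) refl = 1+n≢n e
  adj-irrefl (inj₂ (inj₁ e)) refl = 1+n≢n e
  adj-irrefl (inj₂ (inj₂ (inj₁ (refl , e)))) refl = <-irrefl e (≤-trans (s≤s (s≤s z≤n)) 3≤N)
  adj-irrefl (inj₂ (inj₂ (inj₂ (refl , e)))) refl = <-irrefl e (≤-trans (s≤s (s≤s z≤n)) 3≤N)

  next-next≢ : ∀ {i} → i < N → ¬ next (next i) ≡ i
  next-next≢ {i} i<N with suc i ≟ N
  ... | yes e with 1 ≟ N
  ...   | yes e1 = λ _ → <-irrefl e1 (≤-trans (s≤s (s≤s z≤n)) 3≤N)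
  ...   | no _ = λ eq → <-irrefl (trans (cong suc eq) e) 3≤N
  next-next≢ {i} i<N | no ne with suc (suc i) ≟ N
  ... | yes e = λ eq → <-irrefl (subst (λ k → suc (suc k) ≡ N) (sym eq) e) 3≤N
  ... | no _ = λ eq → <-irrefl (sym eq) (<-trans (n<1+n i) (n<1+n (suc i)))

  next≢prev : ∀ {i} → i < N → ¬ next i ≡ prev i
  next≢prev i<N e = next-next≢ i<N (trans (cong next e) (next-prev i<N))

2n≡n+n : ∀ n → 2 * n ≡ n + n
2n≡n+n n = cong (n +_) (+-identityʳ n)

3≤2n : ∀ {n} → 2 ≤ n → 3 ≤ 2 * n
3≤2n {n} n≥2 = subst (3 ≤_) (sym (2n≡n+n n)) (+-mono-≤ (≤-trans (s≤s z≤n) n≥2) n≥2)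

-- Edge e = {e, next e} gets offset E e, the G-edges at cycle
-- vertex i are shifted by S i, and F i j is the offset of the edge {i, j}.
-- At every vertex i the offsets E i, E (prev i) and the interval
-- [S i, S i + r) tile an interval of length r + 2 (a Block).
module CyclePattern (n r : ℕ) (n≥2 : 2 ≤ n) where
  N : ℕ
  N = 2 * n

  N≡n+n : N ≡ n + n
  N≡n+n = 2n≡n+n n

  open CycleWalk N (3≤2n n≥2) public

  E : ℕ → ℕ
  E e with e <? n
  ... | yes _ = e * suc r + r
  ... | no _ = (N ∸ e) * suc r

  S : ℕ → ℕ
  S zero = 0
  S (suc p) with suc p <? n
  ... | yes _ = suc p * suc r
  ... | no _ = suc ((N ∸ suc p) * suc r)

  F : ℕ → ℕ → ℕ
  F i j with next i ≟ j
  ... | yes _ = E i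
  ... | no _ = E j

  F-next : ∀ i → F i (next i) ≡ E i
  F-next i with next i ≟ next i
  ... | yes _ = refl
  ... | no ne = ⊥-elim (ne refl)

  F-prev : ∀ {i} → i < N → F i (prev i) ≡ E (prev i)
  F-prev {i} i<N with next i ≟ prev i
  ... | yes e = ⊥-elim (next≢prev i<N e)
  ... | no _ = refl

  F-cases : ∀ {i j} → i < N → j < N → CycleAdj N i j →
    (j ≡ next i × F i j ≡ E i) ⊎ (j ≡ prev i × F i j ≡ E (prev i))
  F-cases {i} {j} i<N j<N a with adj-cases i<N j<N a
  ... | inj₁ refl = inj₁ (refl , F-next i)
  ... | inj₂ refl = inj₂ (sym (prev-next j<N) , trans (cong (F (next j)) (sym (prev-next j<N))) (F-prev i<N))

  F-backward : ∀ {k} → k < N → F (next k) k ≡ F k (next k)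
  F-backward {k} k<N = begin
    F (next k) k                ≡⟨ cong (F (next k)) (sym (prev-next k<N)) ⟩
    F (next k) (prev (next k))  ≡⟨ F-prev (next< k<N) ⟩
    E (prev (next k))           ≡⟨ cong E (prev-next k<N) ⟩
    E k                         ≡⟨ sym (F-next k) ⟩
    F k (next k)                ∎
    where open ≡-Reasoning

  F-sym : ∀ {i j} → i < N → j < N → CycleAdj N i j → F i j ≡ F j i
  F-sym {i} {j} i<N j<N a with adj-cases i<N j<N a
  ... | inj₁ refl = sym (F-backward i<N)
  ... | inj₂ refl = F-backward j<N

  -- The offsets b, …, b+r+1 arranged as: the next-edge offset eₙ, the
  -- prev-edge offset eₚ, and the shifted G-block [s, s + r).
  data Block (b eₙ eₚ s : ℕ) : Set where
    at-origin   : eₙ ≡ b + r → eₚ ≡ b + suc r → s ≡ b → Block b eₙ eₚ s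
    rising      : eₙ ≡ b + suc r → eₚ ≡ b → s ≡ suc b → Block b eₙ eₚ s
    falling     : eₙ ≡ b → eₚ ≡ b + suc r → s ≡ suc b → Block b eₙ eₚ s
    at-antipode : eₙ ≡ suc b → eₚ ≡ b → s ≡ suc (suc b) → Block b eₙ eₚ s

  b<b+1+r : ∀ b → b < b + suc r
  b<b+1+r b = subst (b <_) (sym (+-suc b r)) (s≤s (m≤m+n b r))

  block-edges-distinct : ∀ {b eₙ eₚ s} → Block b eₙ eₚ s → ¬ eₙ ≡ eₚ
  block-edges-distinct {b} (at-origin refl refl refl) e = 1+n≢n (sym (+-cancelˡ-≡ b _ _ e))
  block-edges-distinct {b} (rising refl refl refl) e = <-irrefl (sym e) (b<b+1+r b)
  block-edges-distinct {b} (falling refl refl refl) e = <-irrefl e (b<b+1+r b)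
  block-edges-distinct {b} (at-antipode refl refl refl) e = 1+n≢n e

  block-edges-outside : ∀ {b eₙ eₚ s} → Block b eₙ eₚ s →
    (s ≤ eₙ → eₙ < s + r → ⊥) × (s ≤ eₚ → eₚ < s + r → ⊥)
  block-edges-outside {b} (at-origin refl refl refl) = (λ _ lt → <-irrefl refl lt) ,
     λ _ lt → <-asym lt (subst (b + r <_) (sym (+-suc b r)) (n<1+n (b + r)))
  block-edges-outside {b} (rising refl refl refl) = (λ _ lt → <-irrefl (+-suc b r) lt) , λ le _ → <-irrefl refl le
  block-edges-outside {b} (falling refl refl refl) = (λ le _ → <-irrefl refl le) , λ _ lt → <-irrefl (+-suc b r) lt
  block-edges-outside {b} (at-antipode refl refl refl) = (λ le _ → <-irrefl refl le) , λ le _ → <-irrefl refl (<-trans (n<1+n b) le)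

  block-edges-range : ∀ {b eₙ eₚ s} → Block b eₙ eₚ s →
    (b ≤ eₙ × eₙ ≤ b + suc r) × (b ≤ eₚ × eₚ ≤ b + suc r)
  block-edges-range {b} (at-origin refl refl refl) = (m≤m+n b r , +-monoʳ-≤ b (n≤1+n r)) , (m≤m+n b _ , ≤-refl)
  block-edges-range {b} (rising refl refl refl) = (m≤m+n b _ , ≤-refl) , (≤-refl , m≤m+n b _)
  block-edges-range {b} (falling refl refl refl) = (≤-refl , m≤m+n b _) , (m≤m+n b _ , ≤-refl)
  block-edges-range {b} (at-antipode refl refl refl) = (n≤1+n b , b<b+1+r b) , (≤-refl , m≤m+n b _)

  block-shift-range : ∀ {b eₙ eₚ s} → Block b eₙ eₚ s → ∀ k → s ≤ k → k < s + r → b ≤ k × k ≤ b + suc r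
  block-shift-range {b} {s = s} blk k s≤k k<s+r = ≤-trans (b≤s blk) s≤k , ≤-pred (≤-trans k<s+r (s+r≤ blk))
    where
    b≤s : ∀ {eₙ eₚ s} → Block b eₙ eₚ s → b ≤ s
    b≤s (at-origin _ _ refl) = ≤-refl
    b≤s (rising _ _ refl) = n≤1+n b
    b≤s (falling _ _ refl) = n≤1+n b
    b≤s (at-antipode _ _ refl) = ≤-trans (n≤1+n b) (n≤1+n _)
    s+r≤ : ∀ {eₙ eₚ s} → Block b eₙ eₚ s → s + r ≤ suc (b + suc r)
    s+r≤ (at-origin _ _ refl) = ≤-trans (n≤1+n _) (s≤s (+-monoʳ-≤ b (n≤1+n r)))
    s+r≤ (rising _ _ refl) = s≤s (+-monoʳ-≤ b (n≤1+n r))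
    s+r≤ (falling _ _ refl) = s≤s (+-monoʳ-≤ b (n≤1+n r))
    s+r≤ (at-antipode _ _ refl) = s≤s (≤-reflexive (sym (+-suc b r)))

  block-covers : ∀ {b eₙ eₚ s} → Block b eₙ eₚ s → ∀ k → b ≤ k → k ≤ b + suc r →
    k ≡ eₙ ⊎ k ≡ eₚ ⊎ (s ≤ k × k < s + r)
  block-covers {b} (at-origin refl refl refl) k b≤k k≤ with <-cmp k (b + r)
  ... | tri< lt _ _ = inj₂ (inj₂ (b≤k , lt))
  ... | tri≈ _ eq _ = inj₁ eq
  ... | tri> _ _ gt = inj₂ (inj₁ (≤-antisym k≤ (≤-trans (≤-reflexive (+-suc b r)) gt)))
  block-covers {b} (rising refl refl refl) k b≤k k≤ with <-cmp b k
  ... | tri≈ _ eq _ = inj₂ (inj₁ (sym eq))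
  ... | tri> _ _ gt = ⊥-elim (<-irrefl refl (<-≤-trans gt b≤k))
  ... | tri< lt _ _ with <-cmp k (suc b + r)
  ...   | tri< lt2 _ _ = inj₂ (inj₂ (lt , lt2))
  ...   | tri≈ _ eq _ = inj₁ (trans eq (sym (+-suc b r)))
  ...   | tri> _ _ gt = ⊥-elim (<-irrefl refl (≤-<-trans k≤ (subst (_< k) (sym (+-suc b r)) gt)))
  block-covers {b} (falling refl refl refl) k b≤k k≤ with <-cmp b k
  ... | tri≈ _ eq _ = inj₁ (sym eq)
  ... | tri> _ _ gt = ⊥-elim (<-irrefl refl (<-≤-trans gt b≤k))
  ... | tri< lt _ _ with <-cmp k (suc b + r)
  ...   | tri< lt2 _ _ = inj₂ (inj₂ (lt , lt2))
  ...   | tri≈ _ eq _ = inj₂ (inj₁ (trans eq (sym (+-suc b r))))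
  ...   | tri> _ _ gt = ⊥-elim (<-irrefl refl (≤-<-trans k≤ (subst (_< k) (sym (+-suc b r)) gt)))
  block-covers {b} (at-antipode refl refl refl) k b≤k k≤ with <-cmp b k
  ... | tri≈ _ eq _ = inj₂ (inj₁ (sym eq))
  ... | tri> _ _ gt = ⊥-elim (<-irrefl refl (<-≤-trans gt b≤k))
  ... | tri< lt _ _ with <-cmp (suc b) k
  ...   | tri≈ _ eq _ = inj₁ (sym eq)
  ...   | tri> _ _ gt = ⊥-elim (<-irrefl refl (<-≤-trans gt lt))
  ...   | tri< lt2 _ _ = inj₂ (inj₂ (lt2 , s≤s (subst (k ≤_) (+-suc b r) k≤)))

  E-first-half : ∀ {e} → e < n → E e ≡ e * suc r + r
  E-first-half {e} lt with e <? n
  ... | yes _ = refl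
  ... | no nl = ⊥-elim (nl lt)

  E-second-half : ∀ {e} → ¬ e < n → E e ≡ (N ∸ e) * suc r
  E-second-half {e} nl with e <? n
  ... | yes lt = ⊥-elim (nl lt)
  ... | no _ = refl

  S-first-half : ∀ {p} → suc p < n → S (suc p) ≡ suc p * suc r
  S-first-half {p} lt with suc p <? n
  ... | yes _ = refl
  ... | no nl = ⊥-elim (nl lt)

  S-second-half : ∀ {p} → ¬ suc p < n → S (suc p) ≡ suc ((N ∸ suc p) * suc r)
  S-second-half {p} nl with suc p <? n
  ... | yes lt = ⊥-elim (nl lt)
  ... | no _ = refl

  N∸n≡n : N ∸ n ≡ n
  N∸n≡n = trans (cong (_∸ n) N≡n+n) (m+n∸n≡m n n)

  S-antipode : ∀ p → n ≡ suc p → S (suc p) ≡ suc (n * suc r)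
  S-antipode p e = trans (S-second-half (λ lt → <-irrefl (sym e) lt))
    (cong suc (cong (_* suc r) (trans (cong (N ∸_) (sym e)) N∸n≡n)))

  S-at-n : S n ≡ suc (n * suc r)
  S-at-n = subst (λ m → S m ≡ suc (n * suc r)) (sym n≡1+[n-1]) (S-antipode (pred n) n≡1+[n-1])
    where
    n≡1+[n-1] : n ≡ suc (pred n)
    n≡1+[n-1] = sym (suc-pred n {{>-nonZero (≤-trans (s≤s z≤n) n≥2)}})

  VertexBlock : ℕ → ℕ → Set
  VertexBlock i b = Block b (E i) (E (prev i)) (S i)

  block-origin : VertexBlock 0 0
  block-origin = at-origin (E-first-half (≤-trans (s≤s z≤n) n≥2)) (trans (E-second-half N-1≮n) E-last) refl
    where
    N-1≮n : ¬ pred N < n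
    N-1≮n lt = <-irrefl refl (≤-<-trans (≤-trans (+-monoˡ-≤ n (≤-trans (s≤s z≤n) n≥2))
                 (≤-reflexive (trans (sym N≡n+n) (sym 1+[N-1]≡N)))) (s≤s lt))
    E-last : (N ∸ pred N) * suc r ≡ suc r
    E-last = trans (cong (λ k → (k ∸ pred N) * suc r) (sym 1+[N-1]≡N))
               (trans (cong (_* suc r) (m+n∸n≡m 1 (pred N))) (+-identityʳ (suc r)))

  suc-offset : ∀ q r → suc q * suc r ≡ suc (q * suc r + r)
  suc-offset = solve-∀

  block-first-half : ∀ q → suc q ≤ n → VertexBlock (suc q) (q * suc r + r)
  block-first-half q sq≤n with <-cmp (suc q) n
  ... | tri< lt _ _ = rising (trans (E-first-half lt) (next-offset q r)) (E-first-half (<-trans (n<1+n q) lt))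
                        (trans (S-first-half lt) (suc-offset q r))
    where
    next-offset : ∀ q r → suc q * suc r + r ≡ (q * suc r + r) + suc r
    next-offset = solve-∀
  ... | tri> _ _ gt = ⊥-elim (<-irrefl refl (<-≤-trans gt sq≤n))
  ... | tri≈ _ eq _ = at-antipode (trans (E-second-half (λ lt → <-irrefl eq lt)) antipode-offset)
                        (E-first-half (subst (q <_) eq (n<1+n q)))
                        (trans (S-antipode q (sym eq)) (cong suc (trans (cong (_* suc r) (sym eq)) (suc-offset q r))))
    where
    antipode-offset : (N ∸ suc q) * suc r ≡ suc (q * suc r + r)
    antipode-offset = trans (cong (λ k → (N ∸ k) * suc r) eq)
                        (trans (cong (_* suc r) (trans N∸n≡n (sym eq))) (suc-offset q r))

  block-second-half : ∀ p → n ≤ p → suc p < N → VertexBlock (suc p) ((N ∸ suc p) * suc r)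
  block-second-half p n≤p lt = falling (E-second-half 1+p≮n)
    (trans (E-second-half p≮n) (trans (cong (_* suc r) (+-∸-assoc 1 {N} (<⇒≤ lt))) (+-comm (suc r) _)))
    (S-second-half 1+p≮n)
    where
    1+p≮n : ¬ suc p < n
    1+p≮n l = <-irrefl refl (<-trans l (s≤s n≤p))
    p≮n : ¬ p < n
    p≮n l = <-irrefl refl (<-≤-trans l n≤p)

  n≤n[1+r] : n ≤ n * suc r
  n≤n[1+r] = subst (_≤ n * suc r) (*-identityʳ n) (*-monoʳ-≤ n (s≤s z≤n))

  first-half-bound : ∀ {p} → suc p ≤ n → (p * suc r + r) + 1 ≤ n * suc r
  first-half-bound {p} le =
    subst (_≤ n * suc r) (trans (suc-offset p r) (+-comm 1 _)) (*-monoˡ-≤ (suc r) le)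

  block-at : ∀ i → i < N → Σ ℕ λ b → b + 1 ≤ n * suc r × VertexBlock i b
  block-at zero _ = 0 , ≤-trans (≤-trans (s≤s z≤n) n≥2) n≤n[1+r] , block-origin
  block-at (suc p) lt with <-cmp (suc p) n
  ... | tri< l _ _ = _ , first-half-bound (<⇒≤ l) , block-first-half p (<⇒≤ l)
  ... | tri≈ _ e _ = _ , first-half-bound (≤-reflexive e) , block-first-half p (≤-reflexive e)
  ... | tri> _ _ g = _ , second-half-bound , block-second-half p (≤-pred g) lt
    where
    d≤n : suc (N ∸ suc p) ≤ n
    d≤n = ≤-trans (≤-reflexive (sym (+-∸-assoc 1 {N} (<⇒≤ lt))))
            (≤-trans (∸-monoʳ-≤ N (≤-pred g)) (≤-reflexive N∸n≡n))
    second-half-bound : (N ∸ suc p) * suc r + 1 ≤ n * suc r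
    second-half-bound = ≤-trans (≤-trans (≤-reflexive (+-comm _ 1)) (+-monoˡ-≤ _ (s≤s z≤n))) (*-monoˡ-≤ (suc r) d≤n)

-- The interval colouring of G □ C_{2n} with w + (n + 1) + n r colours,
-- built from an interval w-colouring α of the r-regular graph G:
--   G-edge (x,i)(y,i)     gets  α x y + S i,
--   cycle edge (x,i)(x,j) gets  low x + F i j,
-- where [low x, low x + r) is the spectrum of x.  At (x,i) the colours are
-- then exactly low x + (the block of i), an interval of length r + 2.
-- A vertex x₀ with low x₀ = 1 realises the small colours along the cycle,
-- and the G-layer at the antipode n realises the large ones.
module ProductColouring (G : Graph) (n r w : ℕ) (n≥2 : 2 ≤ n) (α : V G → V G → ℕ)
  (isα : IsIntervalColoring G w α) (spec : ∀ x → Spectra.Spectrum G w α isα x r)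
  (x₀ : V G) (low-x₀≡1 : Spectra.Spectrum.low (spec x₀) ≡ 1) where

  open CyclePattern n r n≥2
  open Spectra G w α isα using (Spectrum)
  module Sp x = Spectrum (spec x)

  low : V G → ℕ
  low x = Sp.low x
  private
    Adj = _~_ G
    HAdj = _~_ (G □ Cycle N)
    α-sym = proj₁ isα
    α-onto = proj₁ (proj₂ (proj₂ isα))
    α-proper = proj₁ (proj₂ (proj₂ (proj₂ isα)))

  T : ℕ
  T = w + (n + 1) + n * r

  T≡ : T ≡ w + suc (n * suc r)
  T≡ = rearrange w n r
    where
    rearrange : ∀ w n r → w + (n + 1) + n * r ≡ w + suc (n * suc r)
    rearrange = solve-∀

  c : V (G □ Cycle N) → V (G □ Cycle N) → ℕ
  c (x , i) (y , j) with toℕ i ≟ toℕ j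
  ... | yes _ = α x y + S (toℕ i)
  ... | no _ = low x + F (toℕ i) (toℕ j)

  c-G-edge : ∀ x y (i : Fin N) → c (x , i) (y , i) ≡ α x y + S (toℕ i)
  c-G-edge x y i with toℕ i ≟ toℕ i
  ... | yes _ = refl
  ... | no ne = ⊥-elim (ne refl)

  c-cycle-edge : ∀ x (i j : Fin N) → CycleAdj N (toℕ i) (toℕ j) → c (x , i) (x , j) ≡ low x + F (toℕ i) (toℕ j)
  c-cycle-edge x i j a with toℕ i ≟ toℕ j
  ... | yes e = ⊥-elim (adj-irrefl a e)
  ... | no _ = refl

  BlockAt : Fin N → ℕ → Set
  BlockAt i b = VertexBlock (toℕ i) b

  block-at-Fin : (i : Fin N) → Σ ℕ λ b → b + 1 ≤ n * suc r × BlockAt i b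
  block-at-Fin i = block-at (toℕ i) (toℕ<n i)

  block-of : (i : Fin N) → BlockAt i (proj₁ (block-at-Fin i))
  block-of i = proj₂ (proj₂ (block-at-Fin i))

  vertex : (k : ℕ) → k < N → Fin N
  vertex k lt = fromℕ< lt

  block-at-vertex : ∀ {b} k (lt : k < N) → VertexBlock k b → BlockAt (vertex k lt) b
  block-at-vertex {b} k lt blk = subst (λ z → VertexBlock z b) (sym (toℕ-fromℕ< lt)) blk

  G-offset : ∀ {x y} → Adj x y → α x y ≡ low x + (α x y ∸ low x) × α x y ∸ low x < r
  G-offset {x} {y} a = sym (m+[n∸m]≡n lo) ,
    +-cancelˡ-< (low x) _ _ (subst (_< low x + r) (sym (m+[n∸m]≡n lo)) (proj₂ (Sp.inside x a)))
    where lo = proj₁ (Sp.inside x a)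

  colour-in-block : ∀ {x i b} → BlockAt i b → ∀ {q} → HAdj (x , i) q →
    Σ ℕ λ k → c (x , i) q ≡ low x + k × b ≤ k × k ≤ b + suc r
  colour-in-block {x} {i} {b} blk {y , .i} (inj₂ (refl , a)) =
    S (toℕ i) + (α x y ∸ low x) , colour≡ ,
    block-shift-range blk _ (m≤m+n _ _) (+-monoʳ-< (S (toℕ i)) (proj₂ (G-offset a)))
    where
    colour≡ : c (x , i) (y , i) ≡ low x + (S (toℕ i) + (α x y ∸ low x))
    colour≡ = begin
      c (x , i) (y , i)                               ≡⟨ c-G-edge x y i ⟩
      α x y + S (toℕ i)                               ≡⟨ cong (_+ S (toℕ i)) (proj₁ (G-offset a)) ⟩
      low x + (α x y ∸ low x) + S (toℕ i)         ≡⟨ +-assoc (low x) _ _ ⟩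
      low x + ((α x y ∸ low x) + S (toℕ i))       ≡⟨ cong (low x +_) (+-comm (α x y ∸ low x) _) ⟩
      low x + (S (toℕ i) + (α x y ∸ low x))       ∎
      where open ≡-Reasoning
  colour-in-block {x} {i} {b} blk {.x , j} (inj₁ (refl , a)) with F-cases (toℕ<n i) (toℕ<n j) a
  ... | inj₁ (_ , F≡) = F (toℕ i) (toℕ j) , c-cycle-edge x i j a ,
          subst (λ z → b ≤ z × z ≤ b + suc r) (sym F≡) (proj₁ (block-edges-range blk))
  ... | inj₂ (_ , F≡) = F (toℕ i) (toℕ j) , c-cycle-edge x i j a ,
          subst (λ z → b ≤ z × z ≤ b + suc r) (sym F≡) (proj₂ (block-edges-range blk))

  cycle-neighbour : ∀ {x k} (i : Fin N) j (j<N : j < N) → CycleAdj N (toℕ i) j → F (toℕ i) j ≡ k →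
    ∃[ q ] (HAdj (x , i) q × c (x , i) q ≡ low x + k)
  cycle-neighbour {x} i j j<N a F≡ = (x , vertex j j<N) , inj₁ (refl , a') ,
    trans (c-cycle-edge x i _ a') (cong (low x +_) (trans (cong (F (toℕ i)) (toℕ-fromℕ< j<N)) F≡))
    where
    a' : CycleAdj N (toℕ i) (toℕ (vertex j j<N))
    a' = subst (CycleAdj N (toℕ i)) (sym (toℕ-fromℕ< j<N)) a

  block-realised : ∀ {x i b} → BlockAt i b → ∀ k → b ≤ k → k ≤ b + suc r →
    ∃[ q ] (HAdj (x , i) q × c (x , i) q ≡ low x + k)
  block-realised {x} {i} {b} blk k b≤k k≤ with block-covers blk k b≤k k≤
  ... | inj₁ refl = cycle-neighbour i (next (toℕ i)) (next< (toℕ<n i)) (adj-next (toℕ i)) (F-next (toℕ i))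
  ... | inj₂ (inj₁ refl) = cycle-neighbour i (prev (toℕ i)) (prev< (toℕ<n i)) (adj-prev (toℕ<n i)) (F-prev (toℕ<n i))
  ... | inj₂ (inj₂ (s≤k , k<s+r))
      with Sp.realised x (low x + (k ∸ S (toℕ i))) (m≤m+n _ _)
             (+-monoʳ-< (low x) (subst (k ∸ S (toℕ i) <_) (m+n∸m≡n (S (toℕ i)) r) (∸-monoˡ-< k<s+r s≤k)))
  ... | y , a , α≡ = (y , i) , inj₂ (refl , a) , (begin
      c (x , i) (y , i)                        ≡⟨ c-G-edge x y i ⟩
      α x y + S (toℕ i)                        ≡⟨ cong (_+ S (toℕ i)) α≡ ⟩
      low x + (k ∸ S (toℕ i)) + S (toℕ i)    ≡⟨ +-assoc (low x) _ _ ⟩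
      low x + (k ∸ S (toℕ i) + S (toℕ i))    ≡⟨ cong (low x +_) (m∸n+n≡m s≤k) ⟩
      low x + k                              ∎)
    where open ≡-Reasoning

  c-sym : ∀ {p q} → HAdj p q → c p q ≡ c q p
  c-sym {x , i} {y , .i} (inj₂ (refl , a)) = begin
    c (x , i) (y , i)     ≡⟨ c-G-edge x y i ⟩
    α x y + S (toℕ i)     ≡⟨ cong (_+ S (toℕ i)) (α-sym a) ⟩
    α y x + S (toℕ i)     ≡⟨ sym (c-G-edge y x i) ⟩
    c (y , i) (x , i)     ∎
    where open ≡-Reasoning
  c-sym {x , i} {.x , j} (inj₁ (refl , a)) = begin
    c (x , i) (x , j)          ≡⟨ c-cycle-edge x i j a ⟩
    low x + F (toℕ i) (toℕ j)  ≡⟨ cong (low x +_) (F-sym (toℕ<n i) (toℕ<n j) a) ⟩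
    low x + F (toℕ j) (toℕ i)  ≡⟨ sym (c-cycle-edge x j i (adj-sym a)) ⟩
    c (x , j) (x , i)          ∎
    where open ≡-Reasoning

  -- all colours lie in [1, T]: low x ≥ 1, and the block offsets stay below
  -- n(r+1) + r + 1 while low x + r ≤ w + 1
  c-range : ∀ {p q} → HAdj p q → 1 ≤ c p q × c p q ≤ T
  c-range {x , i} a with block-at-Fin i
  ... | b , b+1≤ , blk with colour-in-block blk a
  ... | k , c≡ , _ , k≤ = subst (1 ≤_) (sym c≡) (≤-trans (Sp.low≥1 x) (m≤m+n _ _)) ,
        subst (_≤ T) (sym c≡) (begin
          low x + k                    ≤⟨ +-monoʳ-≤ (low x) k≤ ⟩
          low x + (b + suc r)          ≡⟨ regroup (low x) b r ⟩
          (low x + r) + (b + 1)        ≤⟨ +-mono-≤ (Sp.low+d≤ x) b+1≤ ⟩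
          suc w + n * suc r            ≡⟨ sym (+-suc w _) ⟩
          w + suc (n * suc r)          ≡⟨ sym T≡ ⟩
          T                            ∎)
    where
    open ≤-Reasoning
    regroup : ∀ a b r → a + (b + suc r) ≡ (a + r) + (b + 1)
    regroup = solve-∀

  G-colour-offset : ∀ {x y s v} → Adj x y → α x y + s ≡ low x + v → s ≤ v × v < s + r
  G-colour-offset {x} {y} {s} {v} a eq = subst (s ≤_) v≡ (m≤n+m s o) ,
    subst (_< s + r) v≡ (subst (o + s <_) (+-comm r s) (+-monoˡ-< s o<r))
    where
    o = α x y ∸ low x
    o<r = proj₂ (G-offset a)
    v≡ : o + s ≡ v
    v≡ = +-cancelˡ-≡ (low x) _ _ (begin
      low x + (o + s)   ≡⟨ sym (+-assoc (low x) o s) ⟩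
      low x + o + s     ≡⟨ cong (_+ s) (sym (proj₁ (G-offset a))) ⟩
      α x y + s         ≡⟨ eq ⟩
      low x + v         ∎)
      where open ≡-Reasoning

  G-colour≢cycle-colour : ∀ {x y b} {i j : Fin N} → BlockAt i b → Adj x y → CycleAdj N (toℕ i) (toℕ j) →
    ¬ α x y + S (toℕ i) ≡ low x + F (toℕ i) (toℕ j)
  G-colour≢cycle-colour {i = i} {j} blk a ca eq with G-colour-offset a eq | F-cases (toℕ<n i) (toℕ<n j) ca
  ... | s≤v , v< | inj₁ (_ , F≡) = proj₁ (block-edges-outside blk) (subst (_ ≤_) F≡ s≤v) (subst (_< _) F≡ v<)
  ... | s≤v , v< | inj₂ (_ , F≡) = proj₂ (block-edges-outside blk) (subst (_ ≤_) F≡ s≤v) (subst (_< _) F≡ v<)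

  F-injective : ∀ {i j₁ j₂ : Fin N} → CycleAdj N (toℕ i) (toℕ j₁) → CycleAdj N (toℕ i) (toℕ j₂) →
    F (toℕ i) (toℕ j₁) ≡ F (toℕ i) (toℕ j₂) → j₁ ≡ j₂
  F-injective {i} {j₁} {j₂} a₁ a₂ F≡ with F-cases (toℕ<n i) (toℕ<n j₁) a₁ | F-cases (toℕ<n i) (toℕ<n j₂) a₂
  ... | inj₁ (e₁ , _) | inj₁ (e₂ , _) = toℕ-injective (trans e₁ (sym e₂))
  ... | inj₂ (e₁ , _) | inj₂ (e₂ , _) = toℕ-injective (trans e₁ (sym e₂))
  ... | inj₁ (_ , f₁) | inj₂ (_ , f₂) = ⊥-elim (block-edges-distinct (block-of i) (trans (sym f₁) (trans F≡ f₂)))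
  ... | inj₂ (_ , f₁) | inj₁ (_ , f₂) = ⊥-elim (block-edges-distinct (block-of i) (trans (sym f₂) (trans (sym F≡) f₁)))

  c-proper : ∀ {p q₁ q₂} → HAdj p q₁ → HAdj p q₂ → c p q₁ ≡ c p q₂ → q₁ ≡ q₂
  c-proper {x , i} {y₁ , .i} {y₂ , .i} (inj₂ (refl , a₁)) (inj₂ (refl , a₂)) eq =
    cong (_, i) (α-proper a₁ a₂ (+-cancelʳ-≡ (S (toℕ i)) _ _
      (trans (sym (c-G-edge x y₁ i)) (trans eq (c-G-edge x y₂ i)))))
  c-proper {x , i} {y₁ , .i} {.x , j₂} (inj₂ (refl , a₁)) (inj₁ (refl , a₂)) eq =
    ⊥-elim (G-colour≢cycle-colour (block-of i) a₁ a₂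
      (trans (sym (c-G-edge x y₁ i)) (trans eq (c-cycle-edge x i j₂ a₂))))
  c-proper {x , i} {.x , j₁} {y₂ , .i} (inj₁ (refl , a₁)) (inj₂ (refl , a₂)) eq =
    ⊥-elim (G-colour≢cycle-colour (block-of i) a₂ a₁
      (trans (sym (c-G-edge x y₂ i)) (trans (sym eq) (c-cycle-edge x i j₁ a₁))))
  c-proper {x , i} {.x , j₁} {.x , j₂} (inj₁ (refl , a₁)) (inj₁ (refl , a₂)) eq =
    cong (x ,_) (F-injective a₁ a₂ (+-cancelˡ-≡ (low x) _ _
      (trans (sym (c-cycle-edge x i j₁ a₁)) (trans eq (c-cycle-edge x i j₂ a₂)))))

  c-interval : ∀ {p q₁ q₂} k → HAdj p q₁ → HAdj p q₂ → c p q₁ ≤ k → k ≤ c p q₂ →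
    ∃[ q ] (HAdj p q × c p q ≡ k)
  c-interval {x , i} k a₁ a₂ le₁ le₂ with block-at-Fin i
  ... | b , _ , blk with colour-in-block blk a₁ | colour-in-block blk a₂
  ... | k₁ , c≡₁ , b≤k₁ , _ | k₂ , c≡₂ , _ , k₂≤ with block-realised blk (k ∸ low x) b≤k-low k-low≤
    where
    low≤k : low x + k₁ ≤ k
    low≤k = subst (_≤ k) c≡₁ le₁
    b≤k-low : b ≤ k ∸ low x
    b≤k-low = subst (_≤ k ∸ low x) (m+n∸m≡n (low x) b)
                (∸-monoˡ-≤ (low x) (≤-trans (+-monoʳ-≤ (low x) b≤k₁) low≤k))
    k-low≤ : k ∸ low x ≤ b + suc r
    k-low≤ = subst (k ∸ low x ≤_) (m+n∸m≡n (low x) _)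
               (∸-monoˡ-≤ (low x) (≤-trans le₂ (≤-trans (≤-reflexive c≡₂) (+-monoʳ-≤ (low x) k₂≤))))
  ... | q , a , c≡ = q , a , trans c≡ (m+[n∸m]≡n (≤-trans (m≤m+n (low x) k₁) (subst (_≤ k) c≡₁ le₁)))

  n<N : n < N
  n<N = subst (n <_) (sym N≡n+n) (m<m+n n (≤-trans (s≤s z≤n) n≥2))

  at-x₀ : ∀ {i k} → ∃[ q ] (HAdj (x₀ , i) q × c (x₀ , i) q ≡ low x₀ + k) →
    ∃[ p ] ∃[ q ] (HAdj p q × c p q ≡ suc k)
  at-x₀ {i} {k} (q , a , c≡) = (x₀ , i) , q , a , trans c≡ (cong (_+ k) low-x₀≡1)

  -- the blocks of the cycle vertices 0, …, q cover the offsets 0, …, q(r+1)+r,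
  -- so the colours 1, …, q(r+1)+r+1 occur at the copies of x₀
  small-colours : ∀ q → q ≤ n → ∀ k → k ≤ q * suc r + r → ∃[ p ] ∃[ p' ] (HAdj p p' × c p p' ≡ suc k)
  small-colours zero _ k k≤ =
    at-x₀ (block-realised (block-at-vertex 0 0<N block-origin) k z≤n (≤-trans k≤ (n≤1+n r)))
  small-colours (suc q) 1+q≤n k k≤ with k ≤? q * suc r + r
  ... | yes k≤' = small-colours q (<⇒≤ 1+q≤n) k k≤'
  ... | no k≰ = at-x₀ (block-realised (block-at-vertex (suc q) 1+q<N (block-first-half q 1+q≤n))
                         k (<⇒≤ (≰⇒> k≰)) (≤-trans k≤ (≤-reflexive (offset q r))))
    where
    1+q<N = ≤-<-trans 1+q≤n n<N
    offset : ∀ q r → suc q * suc r + r ≡ (q * suc r + r) + suc r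
    offset = solve-∀

  -- above n(r+1)+1 the colours are α-colours shifted by S n = n(r+1)+1,
  -- realised in the G-layer at the antipodal vertex n
  large-colours : ∀ k → suc (n * suc r) < k → k ≤ T → ∃[ p ] ∃[ q ] (HAdj p q × c p q ≡ k)
  large-colours k s<k k≤T with α-onto (k ∸ s) (m<n⇒0<n∸m s<k)
                                  (subst (k ∸ s ≤_) (m+n∸n≡m w s) (∸-monoˡ-≤ s (≤-trans k≤T (≤-reflexive T≡))))
    where s = suc (n * suc r)
  ... | x , y , a , α≡ = (x , antipode) , (y , antipode) , inj₂ (refl , a) , (begin
      c (x , antipode) (y , antipode)       ≡⟨ c-G-edge x y antipode ⟩
      α x y + S (toℕ antipode)              ≡⟨ cong₂ _+_ α≡ (trans (cong S (toℕ-fromℕ< n<N)) S-at-n) ⟩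
      k ∸ suc (n * suc r) + suc (n * suc r) ≡⟨ m∸n+n≡m (<⇒≤ s<k) ⟩
      k                                     ∎)
    where
    open ≡-Reasoning
    antipode = vertex n n<N

  c-onto : ∀ k → 1 ≤ k → k ≤ T → ∃[ p ] ∃[ q ] (HAdj p q × c p q ≡ k)
  c-onto (suc k) _ k≤T with suc k ≤? suc (n * suc r)
  ... | yes le = small-colours n ≤-refl k (≤-trans (≤-pred le) (m≤m+n _ r))
  ... | no nle = large-colours (suc k) (≰⇒> nle) k≤T

  product-colouring : HasIntervalColoring (G □ Cycle N) T
  product-colouring = c , c-sym , c-range , c-onto , c-proper , c-interval

-- W(C_{2n}) ≤ n + 1.  Number the edges e = {e, next e}; consecutive edges
-- share a vertex of degree 2, so their colours differ by at most one.
-- Hence colours of edges at cyclic distance d differ by at most d ≤ n, and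
-- the edges coloured 1 and t give t - 1 ≤ n.
module CycleUpperBound (n : ℕ) (n≥2 : 2 ≤ n) (t : ℕ) (c : Fin (2 * n) → Fin (2 * n) → ℕ)
          (isc : IsIntervalColoring (Cycle (2 * n)) t c) where
  N = 2 * n
  open CycleWalk N (3≤2n n≥2)
  private
    c-sym = proj₁ isc
    c-onto = proj₁ (proj₂ (proj₂ isc))
    c-interval = proj₂ (proj₂ (proj₂ (proj₂ isc)))
    Adj = _~_ (Cycle N)

  vertex : ℕ → Fin N
  vertex e with e <? N
  ... | yes p = fromℕ< p
  ... | no _ = fromℕ< 0<N

  toℕ-vertex : ∀ {e} → e < N → toℕ (vertex e) ≡ e
  toℕ-vertex {e} lt with e <? N
  ... | yes p = toℕ-fromℕ< p
  ... | no nl = ⊥-elim (nl lt)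

  vertex-toℕ : (i : Fin N) → vertex (toℕ i) ≡ i
  vertex-toℕ i = toℕ-injective (toℕ-vertex (toℕ<n i))

  adj-vertex : ∀ {e j} → e < N → j < N → CycleAdj N e j → Adj (vertex e) (vertex j)
  adj-vertex l₁ l₂ a = subst₂ (CycleAdj N) (sym (toℕ-vertex l₁)) (sym (toℕ-vertex l₂)) a

  g : ℕ → ℕ
  g e = c (vertex e) (vertex (next e))

  -- at a vertex whose only neighbours are A and B, the colour of VA is at
  -- most one more than that of VB (the colour in between would need a third edge)
  two-neighbours : ∀ {V A B} → Adj V A → Adj V B → (∀ {W} → Adj V W → W ≡ A ⊎ W ≡ B) → c V A ≤ suc (c V B)
  two-neighbours {V} {A} {B} aA aB nb with c V A ≤? suc (c V B)
  ... | yes le = le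
  ... | no nle with c-interval (suc (c V B)) aB aA (n≤1+n _) (<⇒≤ (≰⇒> nle))
  ...   | W , aW , eq with nb aW
  ...     | inj₁ refl = ⊥-elim (nle (≤-reflexive eq))
  ...     | inj₂ refl = ⊥-elim (1+n≢n (sym eq))

  consecutive : ∀ e → e < N → g (next e) ≤ suc (g e) × g e ≤ suc (g (next e))
  consecutive e lt = subst (λ z → g (next e) ≤ suc z) (sym (c-sym aV)) (two-neighbours aB aA nb′) ,
                     subst (_≤ suc (g (next e))) (sym (c-sym aV)) (two-neighbours aA aB nb)
    where
    v = next e
    v< = next< lt
    aA : Adj (vertex v) (vertex e)
    aA = adj-vertex v< lt (subst (CycleAdj N v) (prev-next lt) (adj-prev v<))
    aV : Adj (vertex e) (vertex v)
    aV = adj-vertex lt v< (adj-next e)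
    aB : Adj (vertex v) (vertex (next v))
    aB = adj-vertex v< (next< v<) (adj-next v)
    nb : ∀ {W} → Adj (vertex v) W → W ≡ vertex e ⊎ W ≡ vertex (next v)
    nb {W} a with adj-cases v< (toℕ<n W) (subst (λ z → CycleAdj N z (toℕ W)) (toℕ-vertex v<) a)
    ... | inj₁ eq = inj₂ (toℕ-injective (trans eq (sym (toℕ-vertex (next< v<)))))
    ... | inj₂ eq = inj₁ (toℕ-injective (trans (trans (sym (prev-next (toℕ<n W))) (trans (cong prev (sym eq)) (prev-next lt)))
                                                (sym (toℕ-vertex lt))))
    nb′ : ∀ {W} → Adj (vertex v) W → W ≡ vertex (next v) ⊎ W ≡ vertex e
    nb′ a with nb a
    ... | inj₁ x = inj₂ x
    ... | inj₂ x = inj₁ x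

  forward : ∀ a k → a + k < N → g (a + k) ≤ g a + k
  forward a zero lt = ≤-reflexive (trans (cong g (+-identityʳ a)) (sym (+-identityʳ (g a))))
  forward a (suc k) lt = subst (λ z → g z ≤ g a + suc k) (sym (+-suc a k))
     (≤-trans (subst (λ z → g z ≤ suc (g (a + k))) (next-suc lt′) (proj₁ (consecutive (a + k) (<-trans (n<1+n _) lt′))))
              (≤-trans (s≤s (forward a k (<-trans (n<1+n _) lt′))) (≤-reflexive (sym (+-suc (g a) k)))))
    where lt′ : suc (a + k) < N
          lt′ = subst (_< N) (+-suc a k) lt

  backward : ∀ a k → k ≤ a → a < N → g (a ∸ k) ≤ g a + k
  backward a zero _ _ = ≤-reflexive (sym (+-identityʳ (g a)))
  backward a (suc k) 1+k≤a lt = ≤-trans (proj₂ (consecutive e e<))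
    (subst (λ z → suc (g z) ≤ g a + suc k) (sym next-e)
      (≤-trans (s≤s (backward a k (<⇒≤ 1+k≤a) lt)) (≤-reflexive (sym (+-suc (g a) k)))))
    where
    e = a ∸ suc k
    1+e≡ : suc e ≡ a ∸ k
    1+e≡ = sym (+-∸-assoc 1 {a} 1+k≤a)
    1+e< : suc e < N
    1+e< = subst (_< N) (sym 1+e≡) (≤-<-trans (m∸n≤m a k) lt)
    e< : e < N
    e< = <-trans (n<1+n e) 1+e<
    next-e : next e ≡ a ∸ k
    next-e = trans (next-suc 1+e<) 1+e≡

  L = pred N

  L<N : L < N
  L<N = prev< {0} 0<N

  next-L : next L ≡ 0
  next-L = next-prev {0} 0<N

  -- if the forward distance d from a to e exceeds n, the way round through
  -- edge 0 is short: a + (N-1-e) + 1 ≤ n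
  wrap-short : ∀ a d u → suc n ≤ d → suc (a + d + u) ≡ n + n → suc (a + u) ≤ n
  wrap-short a d u d> eq = +-cancelʳ-≤ (suc n) _ _ (≤-trans (+-monoʳ-≤ (suc (a + u)) d>)
     (≤-trans (≤-reflexive (trans (rearrange a d u) eq)) (+-monoʳ-≤ n (n≤1+n n))))
    where rearrange : ∀ a d u → suc (a + u) + d ≡ suc (a + d + u)
          rearrange = solve-∀

  regroup : ∀ X a u → suc (X + a) + u ≡ X + suc (a + u)
  regroup = solve-∀

  split-N : ∀ {a e} → a ≤ e → e ≤ L → suc (a + (e ∸ a) + (L ∸ e)) ≡ n + n
  split-N {a} {e} a≤e e≤L = trans (cong suc (trans (cong (_+ (L ∸ e)) (m+[n∸m]≡n a≤e)) (m+[n∸m]≡n e≤L)))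
                              (trans 1+[N-1]≡N (2n≡n+n n))

  ≤L : ∀ {a} → a < N → a ≤ L
  ≤L {a} a<N = ≤-pred (subst (a <_) (sym 1+[N-1]≡N) a<N)

  -- edges ahead of a: go forward directly, or backward round through edge 0
  ahead : ∀ a e → a ≤ e → e < N → g e ≤ g a + n
  ahead a e a≤e e<N with (e ∸ a) ≤? n
  ... | yes d≤n = ≤-trans (subst (λ z → g z ≤ g a + (e ∸ a)) (m+[n∸m]≡n a≤e)
                    (forward a (e ∸ a) (subst (_< N) (sym (m+[n∸m]≡n a≤e)) e<N))) (+-monoʳ-≤ (g a) d≤n)
  ... | no d≰n = begin
      g e                    ≤⟨ subst (λ z → g z ≤ g L + u) (m∸[m∸n]≡n (≤L e<N)) (backward L u (m∸n≤m L e) L<N) ⟩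
      g L + u                ≤⟨ +-monoˡ-≤ u (subst (λ z → g L ≤ suc (g z)) next-L (proj₂ (consecutive L L<N))) ⟩
      suc (g 0) + u          ≤⟨ +-monoˡ-≤ u (s≤s (subst (λ z → g z ≤ g a + a) (n∸n≡0 a)
                                  (backward a a ≤-refl (≤-<-trans a≤e e<N)))) ⟩
      suc (g a + a) + u      ≡⟨ regroup (g a) a u ⟩
      g a + suc (a + u)      ≤⟨ +-monoʳ-≤ (g a) (wrap-short a (e ∸ a) u (≰⇒> d≰n) (split-N a≤e (≤L e<N))) ⟩
      g a + n                ∎
    where
    open ≤-Reasoning
    u = L ∸ e

  -- edges behind a: go backward directly, or forward round through edge 0
  behind : ∀ a e → e ≤ a → a < N → g e ≤ g a + n
  behind a e e≤a a<N with (a ∸ e) ≤? n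
  ... | yes d≤n = ≤-trans (subst (λ z → g z ≤ g a + (a ∸ e)) (m∸[m∸n]≡n e≤a) (backward a (a ∸ e) (m∸n≤m a e) a<N))
                    (+-monoʳ-≤ (g a) d≤n)
  ... | no d≰n = begin
      g e                    ≤⟨ forward 0 e (≤-<-trans e≤a a<N) ⟩
      g 0 + e                ≤⟨ +-monoˡ-≤ e (subst (λ z → g z ≤ suc (g L)) next-L (proj₁ (consecutive L L<N))) ⟩
      suc (g L) + e          ≤⟨ +-monoˡ-≤ e (s≤s (subst (λ z → g z ≤ g a + u) (m+[n∸m]≡n (≤L a<N))
                                  (forward a u (subst (_< N) (sym (m+[n∸m]≡n (≤L a<N))) L<N)))) ⟩
      suc (g a + u) + e      ≡⟨ regroup (g a) u e ⟩
      g a + suc (u + e)      ≤⟨ +-monoʳ-≤ (g a) (subst (_≤ n) (cong suc (+-comm e u))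
                                  (wrap-short e (a ∸ e) u (≰⇒> d≰n) (split-N e≤a (≤L a<N)))) ⟩
      g a + n                ∎
    where
    open ≤-Reasoning
    u = L ∸ a

  colours-within-n : ∀ a e → a < N → e < N → g e ≤ g a + n
  colours-within-n a e a<N e<N with a ≤? e
  ... | yes a≤e = ahead a e a≤e e<N
  ... | no a≰e = behind a e (<⇒≤ (≰⇒> a≰e)) a<N

  edge-number : ∀ {X Y} → Adj X Y → Σ ℕ λ e → e < N × g e ≡ c X Y
  edge-number {X} {Y} a with adj-cases (toℕ<n X) (toℕ<n Y) a
  ... | inj₁ eq = toℕ X , toℕ<n X , cong₂ c (vertex-toℕ X) (trans (cong vertex (sym eq)) (vertex-toℕ Y))
  ... | inj₂ eq = toℕ Y , toℕ<n Y , trans (cong₂ c (vertex-toℕ Y) (trans (cong vertex (sym eq)) (vertex-toℕ X))) (sym (c-sym a))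

  t≤n+1 : t ≤ n + 1
  t≤n+1 with 1 ≤? t
  ... | no t≱1 = ≤-trans (≤-pred (≰⇒> t≱1)) z≤n
  ... | yes t≥1 with c-onto 1 ≤-refl t≥1 | c-onto t t≥1 ≤-refl
  ... | _ , _ , a₁ , c≡1 | _ , _ , aₜ , c≡t with edge-number a₁ | edge-number aₜ
  ... | e₁ , e₁<N , g≡1 | eₜ , eₜ<N , g≡t =
     subst (_≤ n + 1) (trans g≡t c≡t) (subst (g eₜ ≤_) (trans (cong (_+ n) (trans g≡1 c≡1)) (+-comm 1 n))
       (colours-within-n e₁ eₜ e₁<N eₜ<N))

K₁ : Graph
K₁ = record { V = ⊤ ; _~_ = λ _ _ → ⊥ ; elems = tt ∷ [] ; complete = λ _ → here refl }

K₁-colouring : IsIntervalColoring K₁ 0 (λ _ _ → 0)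
K₁-colouring = (λ ()) , (λ ()) , (λ k 1≤k k≤0 → ⊥-elim (<-irrefl refl (≤-trans 1≤k k≤0))) , (λ ()) , λ _ ()

K₁-isolated : HasDegree K₁ tt 0
K₁-isolated = [] , [] , (λ _ → (λ ()) , λ ()) , refl

K₁□-colouring : ∀ H t → HasIntervalColoring (K₁ □ H) t → HasIntervalColoring H t
K₁□-colouring H t (c , c-sym , c-range , c-onto , c-proper , c-interval) =
  c′ , (λ a → c-sym (layer a)) , (λ a → c-range (layer a)) , onto , proper , interval
  where
  c′ : V H → V H → ℕ
  c′ i j = c (tt , i) (tt , j)
  layer : ∀ {i j} → _~_ H i j → _~_ (K₁ □ H) (tt , i) (tt , j)
  layer a = inj₁ (refl , a)
  onto : ∀ k → 1 ≤ k → k ≤ t → ∃[ i ] ∃[ j ] (_~_ H i j × c′ i j ≡ k)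
  onto k 1≤k k≤t with c-onto k 1≤k k≤t
  ... | (tt , i) , (tt , j) , inj₁ (_ , a) , c≡ = i , j , a , c≡
  proper : ∀ {i j l} → _~_ H i j → _~_ H i l → c′ i j ≡ c′ i l → j ≡ l
  proper a₁ a₂ eq = cong proj₂ (c-proper (layer a₁) (layer a₂) eq)
  interval : ∀ {i j l} k → _~_ H i j → _~_ H i l → c′ i j ≤ k → k ≤ c′ i l → ∃[ v ] (_~_ H i v × c′ i v ≡ k)
  interval k a₁ a₂ le₁ le₂ with c-interval k (layer a₁) (layer a₂) le₁ le₂
  ... | (tt , v) , inj₁ (_ , a) , c≡ = v , a , c≡

cycle-colouring : ∀ n → 2 ≤ n → HasIntervalColoring (Cycle (2 * n)) (n + 1)
cycle-colouring n n≥2 =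
  subst (HasIntervalColoring (Cycle (2 * n))) T≡n+1 (K₁□-colouring (Cycle (2 * n)) T product-colouring)
  where
  open ProductColouring K₁ n 0 0 n≥2 (λ _ _ → 0) K₁-colouring
         (λ _ → Spectra.spectrum K₁ 0 (λ _ _ → 0) K₁-colouring K₁-isolated) tt refl
  T≡n+1 : T ≡ n + 1
  T≡n+1 = trans (cong (n + 1 +_) (*-zeroʳ n)) (+-identityʳ (n + 1))

theorem10 : (G : Graph) → Simple G → (r n : ℕ) → 2 ≤ n → Regular G r →
    IntervalColorable G → (w : ℕ) → IsW G w →
    IntervalColorable (G □ Cycle (2 * n)) ×
    IsW (Cycle (2 * n)) (n + 1) ×
    (∃[ t ] (w + (n + 1) + n * r ≤ t × HasIntervalColoring (G □ Cycle (2 * n)) t))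
theorem10 G _ r n n≥2 regular (t₀ , 1≤t₀ , colourable) w ((α , isα) , maximal) =
  (T , 1≤T , product-colouring) ,
  (cycle-colouring n n≥2 , λ t (c , isc) → CycleUpperBound.t≤n+1 n n≥2 t c isc) ,
  (T , ≤-refl , product-colouring)
  where
  open Spectra G w α isα
  w≥1 : 1 ≤ w
  w≥1 = ≤-trans 1≤t₀ (maximal t₀ colourable)
  spec : ∀ x → Spectrum x r
  spec x = spectrum (regular x)
  edge₁ = proj₁ (proj₂ (proj₂ isα)) 1 ≤-refl w≥1
  x₀ = proj₁ edge₁
  open ProductColouring G n r w n≥2 α isα spec x₀
         (low≡1 (spec x₀) (proj₁ (proj₂ (proj₂ edge₁))) (proj₂ (proj₂ (proj₂ edge₁))))
  1≤T : 1 ≤ T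
  1≤T = ≤-trans w≥1 (≤-trans (m≤m+n w (n + 1)) (m≤m+n _ (n * r)))
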